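{- If $f:\mathbb{N}\to\mathbb{C}$ is completely multiplicative, then, as formal Dirichlet series, $$\widetilde{D}(f,s)=\exp\left(\sum_p\frac{f(p)}{p^s}\right),$$ where the sum is over all primes $p$.
   Context: $f$ is completely multiplicative if $f(1)=1$ and $f(mn)=f(m)f(n)$ for all $m,n$. For $n\in\mathbb{N}$ write $n=\prod_p p^{\nu_p(n)}$ and $\xi(n)=\prod_p\nu_p(n)!$. The exponential Dirichlet series of $f$ is the formal Dirichlet series $\widetilde{D}(f,s)=\sum_{n=1}^\infty\frac{f(n)}{\xi(n)n^s}$. $\exp(t)=\sum_{k\ge0}t^k/k!$ is the formal exponential series, applied to a formal Dirichlet series with zero coefficient at $n=1$ (using the Dirichlet product of formal Dirichlet series). -}

module Defs where

open import Level using (Level)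
open import Data.Nat using (ℕ; zero; suc; _≤_; _≟_; _!)
import Data.Nat as N
open import Data.Nat.Divisibility using (_∣?_)
open import Data.Nat.DivMod using (_/_)
open import Data.Nat.Primality using (prime?)

open import Data.Bool using (if_then_else_)
open import Relation.Nullary.Decidable using (does)
open import Algebra.Bundles using (CommutativeRing)

-- Arithmetic functions on ℕ (values at 0 are irrelevant).

-- p-adic valuation with fuel, for p = 2 + q.
val : ℕ → ℕ → ℕ → ℕ
val zero    q n = 0
val (suc k) q n =
  if does (suc (suc q) ∣? n) then suc (val k q (n / suc (suc q))) else 0

-- ν p n = ν_p(n), the exponent of the prime p in n ≥ 1.
-- (Fuel n suffices since ν_p(n) ≤ n.)
ν : ℕ → ℕ → ℕ
ν zero          n = 0
ν (suc zero)    n = 0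
ν (suc (suc q)) n = val n q n

prodℕ : (ℕ → ℕ) → ℕ → ℕ
prodℕ g zero    = 1
prodℕ g (suc n) = prodℕ g n N.* g (suc n)

-- ξ(n) = ∏_p ν_p(n)!  (only primes p ≤ n can divide n ≥ 1)
ξ : ℕ → ℕ
ξ n = prodℕ (λ p → if does (prime? p) then (ν p n) ! else 1) n

-- Formal Dirichlet series over a commutative ring R: coefficient
-- sequences a : ℕ → Carrier, where a n is the coefficient of n^{-s}
-- (n ≥ 1; the value at 0 is ignored).

module FDS {c ℓ : Level} (R : CommutativeRing c ℓ) where
  open CommutativeRing R

  ι : ℕ → Carrier
  ι zero    = 0#
  ι (suc m) = 1# + ι m

  sumR : (ℕ → Carrier) → ℕ → Carrier
  sumR g zero    = 0#
  sumR g (suc n) = sumR g n + g (suc n)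

  sum0 : (ℕ → Carrier) → ℕ → Carrier
  sum0 g zero    = g 0
  sum0 g (suc n) = sum0 g n + g (suc n)

  Series : Set c
  Series = ℕ → Carrier

  _≋_ : Series → Series → Set ℓ
  a ≋ b = ∀ n → 1 ≤ n → a n ≈ b n

  _⋆_ : Series → Series → Series
  (a ⋆ b) n = sumR (λ d → sumR (λ e → if does (d N.* e ≟ n) then a d * b e else 0#) n) n

  δ : Series
  δ n = if does (n ≟ 1) then 1# else 0#

  _^⋆_ : Series → ℕ → Series
  a ^⋆ zero  = δ
  a ^⋆ suc k = a ⋆ (a ^⋆ k)

  -- Formal exponential exp(a) = Σ_{k≥0} a^{⋆k}/k!, for a with a 1 = 0.
  -- `inv m` is the inverse of ι m (m ≥ 1).  Since a 1 = 0, a^{⋆k}(n) = 0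
  -- whenever 2^k > n, so the coefficient at n is the finite sum over k ≤ n.
  expD : (inv : ℕ → Carrier) → Series → Series
  expD inv a n = sum0 (λ k → inv (k !) * (a ^⋆ k) n) n

  -- Exponential Dirichlet series of f: coefficient f(n)/ξ(n)
  expDS : (inv : ℕ → Carrier) → (ℕ → Carrier) → Series
  expDS inv f n = f n * inv (ξ n)

  primeSeries : (ℕ → Carrier) → Series
  primeSeries f n = if does (prime? n) then f n else 0#

  CompletelyMultiplicative : (ℕ → Carrier) → Set ℓ
  CompletelyMultiplicative f =
    (f 1 ≈ 1#) × (∀ m n → 1 ≤ m → 1 ≤ n → f (m N.* n) ≈ f m * f n)
    where open import Data.Product using (_×_)

-- Let P = Σ_p f(p) p^{-s} and Ω(n) = Σ_p ν_p(n). By induction on k, ξ(n) P^{⋆k}(n) equals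
-- k! f(n) if Ω(n) = k and 0 otherwise: in P^{⋆(k+1)}(n) = Σ_{pe = n} f(p) P^{⋆k}(e) the prime p
-- contributes ν_p(n) k! f(n) / ξ(n), because ξ(pe) = (ν_p(e) + 1) ξ(e), Ω(pe) = Ω(e) + 1 and
-- f(pe) = f(p) f(e), and summing ν_p(n) over p gives the factor Ω(n) = k + 1. So the n-th
-- coefficient of exp(P) = Σ_k P^{⋆k} / k! has the single term f(n) / ξ(n), at k = Ω(n) ≤ n.

module Submission where

open import Defs
open import Level using (Level)
open import Data.Nat using (ℕ; suc; _≤_)
open import Algebra.Bundles using (CommutativeMonoid; CommutativeRing)

module Valuation where

  open import Data.Bool.Properties using (if-cong)
  open import Data.Nat using (zero; _+_; _*_; _<_; z≤n; s≤s; NonTrivial; 2+; nonTrivial⇒n>1; >-nonZero⁻¹)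
  open import Data.Nat.Properties using (≤-refl; ≤-trans; ≤-pred; <⇒≱; m≤m+n; m≤n+m; *-comm; *-mono-≤; m<m*n; *-commutativeSemigroup)
  open import Data.Nat.Divisibility using (_∣_; _∣?_; divides; ∣⇒≤; m∣m*n)
  open import Data.Nat.DivMod using (_/_; m*n/n≡m; m/n<m; m≥n⇒m/n>0)
  open import Data.Nat.Induction using (<-rec)
  open import Data.Nat.Primality using (Prime; euclidsLemma; prime⇒irreducible; prime⇒nonTrivial; prime⇒nonZero; ¬prime[1])
  open import Algebra.Properties.CommutativeSemigroup *-commutativeSemigroup using (x∙yz≈y∙xz)
  open import Data.Sum using (inj₁; inj₂)
  open import Relation.Nullary using (¬_)
  open import Relation.Nullary.Decidable using (yes; no; dec-true; dec-false)
  open import Relation.Nullary.Negation using (contradiction)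
  open import Relation.Binary.PropositionalEquality using (_≡_; _≢_; refl; sym; trans; cong; module ≡-Reasoning)

  val-suc-∣ : ∀ {q m} k → 2+ q ∣ m → val (suc k) q m ≡ suc (val k q (m / 2+ q))
  val-suc-∣ {q} {m} _ p∣m = if-cong (dec-true (2+ q ∣? m) p∣m)

  val-suc-∤ : ∀ {q m} k → ¬ 2+ q ∣ m → val (suc k) q m ≡ 0
  val-suc-∤ {q} {m} _ p∤m = if-cong (dec-false (2+ q ∣? m) p∤m)

  val-fuel : ∀ q {j k m} → 1 ≤ m → m ≤ j → m ≤ k → val j q m ≡ val k q m
  val-fuel q {zero} (s≤s z≤n) ()
  val-fuel q {suc j} {zero} (s≤s z≤n) _ ()
  val-fuel q {suc j} {suc k} {m} (s≤s z≤n) m≤j m≤k with 2+ q ∣? m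
  ... | no p∤m = trans (val-suc-∤ j p∤m) (sym (val-suc-∤ k p∤m))
  ... | yes p∣m = begin
    val (suc j) q m              ≡⟨ val-suc-∣ j p∣m ⟩
    suc (val j q (m / 2+ q))     ≡⟨ cong suc (val-fuel q (m≥n⇒m/n>0 (∣⇒≤ p∣m)) (shrink m≤j) (shrink m≤k)) ⟩
    suc (val k q (m / 2+ q))     ≡⟨ sym (val-suc-∣ k p∣m) ⟩
    val (suc k) q m              ∎
    where
    open ≡-Reasoning
    shrink : ∀ {i} → m ≤ suc i → m / 2+ q ≤ i
    shrink m≤i = ≤-pred (≤-trans (m/n<m m (2+ q) (s≤s (s≤s z≤n))) m≤i)

  ν-∤ : ∀ {p n} .{{_ : NonTrivial p}} → ¬ p ∣ n → ν p n ≡ 0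
  ν-∤ {2+ q} {zero} _ = refl
  ν-∤ {2+ q} {suc n} = val-suc-∤ n

  ν-*-self : ∀ {p x} .{{_ : NonTrivial p}} → 1 ≤ x → ν p (p * x) ≡ suc (ν p x)
  ν-*-self {2+ q} {x@(suc x-1)} 1≤x = begin
    val (suc K) q (p * x)     ≡⟨ val-suc-∣ K (m∣m*n x) ⟩
    suc (val K q (p * x / p)) ≡⟨ cong (λ m → suc (val K q m)) (trans (cong (_/ p) (*-comm p x)) (m*n/n≡m x p)) ⟩
    suc (val K q x)           ≡⟨ cong suc (val-fuel q 1≤x x≤K ≤-refl) ⟩
    suc (ν p x)               ∎
    where
    open ≡-Reasoning
    p = 2+ q
    K = x-1 + suc q * x
    x≤K : x ≤ K
    x≤K = ≤-trans (m≤m+n x (q * x)) (m≤n+m (suc q * x) x-1)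

  ν-large : ∀ {p n} .{{_ : NonTrivial p}} → 1 ≤ n → n < p → ν p n ≡ 0
  ν-large (s≤s z≤n) n<p = ν-∤ (λ p∣n → <⇒≱ n<p (∣⇒≤ p∣n))

  ν-*-other : ∀ {p r x} → Prime p → Prime r → p ≢ r → 1 ≤ x → ν p (r * x) ≡ ν p x
  ν-*-other {p} {r} {x} pp pr p≢r = <-rec (λ x → 1 ≤ x → ν p (r * x) ≡ ν p x) step x
    where
    instance _ = prime⇒nonTrivial pp
    p∤r : ¬ p ∣ r
    p∤r p∣r with prime⇒irreducible pr p∣r
    ... | inj₁ refl = contradiction pp ¬prime[1]
    ... | inj₂ p≡r = p≢r p≡r
    step : ∀ x → (∀ {y} → y < x → 1 ≤ y → ν p (r * y) ≡ ν p y) → 1 ≤ x → ν p (r * x) ≡ ν p x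
    step x rec 1≤x with p ∣? x
    ... | no p∤x = trans (ν-∤ p∤rx) (sym (ν-∤ p∤x))
      where
      p∤rx : ¬ p ∣ r * x
      p∤rx p∣rx with euclidsLemma r x pp p∣rx
      ... | inj₁ p∣r = p∤r p∣r
      ... | inj₂ p∣x = p∤x p∣x
    ... | yes (divides zero refl) = contradiction 1≤x λ ()
    ... | yes (divides y@(suc _) refl) = begin
      ν p (r * (y * p))   ≡⟨ cong (ν p) (trans (cong (r *_) (*-comm y p)) (x∙yz≈y∙xz r p y)) ⟩
      ν p (p * (r * y))   ≡⟨ ν-*-self (*-mono-≤ (>-nonZero⁻¹ r {{prime⇒nonZero pr}}) (s≤s z≤n)) ⟩
      suc (ν p (r * y))   ≡⟨ cong suc (rec (m<m*n y p (nonTrivial⇒n>1 p)) (s≤s z≤n)) ⟩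
      suc (ν p y)         ≡⟨ sym (ν-*-self (s≤s z≤n)) ⟩
      ν p (p * y)         ≡⟨ cong (ν p) (*-comm p y) ⟩
      ν p (y * p)         ∎
      where open ≡-Reasoning

module _ {c ℓ : Level} (M : CommutativeMonoid c ℓ) where

  open CommutativeMonoid M

  module RangeSum (Σ : (ℕ → Carrier) → ℕ → Carrier)
    (Σ-zero : ∀ g → Σ g 0 ≈ ε) (Σ-suc : ∀ g n → Σ g (suc n) ≈ Σ g n ∙ g (suc n))
    where

    open import Data.Bool using (if_then_else_)
    open import Data.Bool.Properties using (if-cong)
    open import Data.Nat using (zero; _*_; _<_; z≤n; s≤s; _≟_; >-nonZero; >-nonZero⁻¹)
    open import Data.Nat.Properties using (≤-refl; ≤-trans; ≤-pred; ≤∧≢⇒<; m≤n⇒m≤1+n; 1+n≰n; m≤m*n; m≤n*m)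
    open import Data.Nat.Primality using (Prime; prime?; prime⇒nonZero; prime⇒nonTrivial)
    open import Relation.Nullary.Decidable using (yes; no; does; dec-true)
    open import Relation.Nullary.Negation using (contradiction)
    open import Relation.Binary.PropositionalEquality as ≡ using (_≢_; cong)
    open Valuation
    open import Algebra.Properties.CommutativeSemigroup commutativeSemigroup using (x∙yz≈y∙xz)
    open import Relation.Binary.Reasoning.Setoid setoid

    private
      below : ∀ {p} {P : ℕ → Set p} {n} → (∀ i → 1 ≤ i → i ≤ suc n → P i) → ∀ i → 1 ≤ i → i ≤ n → P i
      below h i 1≤i i≤n = h i 1≤i (m≤n⇒m≤1+n i≤n)

    Σ-cong : ∀ {g h} n → (∀ i → 1 ≤ i → i ≤ n → g i ≈ h i) → Σ g n ≈ Σ h n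
    Σ-cong {g} {h} zero _ = trans (Σ-zero g) (sym (Σ-zero h))
    Σ-cong {g} {h} (suc n) g≈h = begin
      Σ g (suc n)       ≈⟨ Σ-suc g n ⟩
      Σ g n ∙ g (suc n) ≈⟨ ∙-cong (Σ-cong n (below g≈h)) (g≈h (suc n) (s≤s z≤n) ≤-refl) ⟩
      Σ h n ∙ h (suc n) ≈⟨ sym (Σ-suc h n) ⟩
      Σ h (suc n)       ∎

    Σ-tail : ∀ {g m N} → m ≤ N → (∀ i → m < i → i ≤ N → g i ≈ ε) → Σ g N ≈ Σ g m
    Σ-tail {g} {m} {zero} z≤n _ = refl
    Σ-tail {g} {m} {suc N} m≤N g≈ε with m ≟ suc N
    ... | yes ≡.refl = refl
    ... | no m≢N = begin
      Σ g (suc N)       ≈⟨ Σ-suc g N ⟩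
      Σ g N ∙ g (suc N) ≈⟨ ∙-cong (Σ-tail m≤N-1 (λ i m<i i≤N → g≈ε i m<i (m≤n⇒m≤1+n i≤N)))
                                  (g≈ε (suc N) (s≤s m≤N-1) ≤-refl) ⟩
      Σ g m ∙ ε         ≈⟨ identityʳ _ ⟩
      Σ g m             ∎
      where
      m≤N-1 : m ≤ N
      m≤N-1 = ≤-pred (≤∧≢⇒< m≤N m≢N)

    Σ-ε : ∀ {g} n → (∀ i → 1 ≤ i → i ≤ n → g i ≈ ε) → Σ g n ≈ ε
    Σ-ε {g} n g≈ε = trans (Σ-tail z≤n g≈ε) (Σ-zero g)

    Σ-update : ∀ {g h r x} n → 1 ≤ r → r ≤ n → (∀ i → 1 ≤ i → i ≤ n → i ≢ r → g i ≈ h i) →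
               g r ≈ x ∙ h r → Σ g n ≈ x ∙ Σ h n
    Σ-update {r = r} zero 1≤r r≤0 _ _ = contradiction (≤-trans 1≤r r≤0) λ ()
    Σ-update {g} {h} {r} {x} (suc n) 1≤r r≤n g≈h gr≈x∙hr with r ≟ suc n
    ... | yes ≡.refl = begin
      Σ g (suc n)          ≈⟨ Σ-suc g n ⟩
      Σ g n ∙ g r          ≈⟨ ∙-cong (Σ-cong n (λ i 1≤i i≤n → g≈h i 1≤i (m≤n⇒m≤1+n i≤n) (λ { ≡.refl → 1+n≰n i≤n })))
                                     gr≈x∙hr ⟩
      Σ h n ∙ (x ∙ h r)    ≈⟨ x∙yz≈y∙xz _ _ _ ⟩
      x ∙ (Σ h n ∙ h r)    ≈⟨ ∙-congˡ (sym (Σ-suc h n)) ⟩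
      x ∙ Σ h (suc n)      ∎
    ... | no r≢n = begin
      Σ g (suc n)               ≈⟨ Σ-suc g n ⟩
      Σ g n ∙ g (suc n)         ≈⟨ ∙-cong (Σ-update n 1≤r (≤-pred (≤∧≢⇒< r≤n r≢n)) (below g≈h) gr≈x∙hr)
                                           (g≈h (suc n) (s≤s z≤n) ≤-refl (λ n≡r → r≢n (≡.sym n≡r))) ⟩
      (x ∙ Σ h n) ∙ h (suc n)   ≈⟨ assoc _ _ _ ⟩
      x ∙ (Σ h n ∙ h (suc n))   ≈⟨ ∙-congˡ (sym (Σ-suc h n)) ⟩
      x ∙ Σ h (suc n)           ∎

    Σ-single : ∀ {g} n j → 1 ≤ j → j ≤ n → (∀ i → 1 ≤ i → i ≤ n → i ≢ j → g i ≈ ε) → Σ g n ≈ g j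
    Σ-single {g} n j 1≤j j≤n g≈ε = begin
      Σ g n                ≈⟨ Σ-update n 1≤j j≤n g≈ε (sym (identityʳ _)) ⟩
      g j ∙ Σ (λ _ → ε) n  ≈⟨ ∙-congˡ (Σ-ε n (λ _ _ _ → refl)) ⟩
      g j ∙ ε              ≈⟨ identityʳ _ ⟩
      g j                  ∎

    primeΣ : (ℕ → Carrier) → ℕ → Carrier
    primeΣ φ n = Σ (λ p → if does (prime? p) then φ (ν p n) else ε) n

    primeΣ-*-prime : ∀ {φ p x c} → φ 0 ≈ ε → Prime p → 1 ≤ x → φ (suc (ν p x)) ≈ c ∙ φ (ν p x) →
                     primeΣ φ (p * x) ≈ c ∙ primeΣ φ x
    primeΣ-*-prime {φ} {p} {x} {c} φ0≈ε pp 1≤x φ-step = begin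
      primeΣ φ (p * x)          ≈⟨ Σ-update (p * x) 1≤p (m≤m*n p x) off-p at-p ⟩
      c ∙ Σ (term x) (p * x)    ≈⟨ ∙-congˡ (Σ-tail (m≤n*m x p) beyond-x) ⟩
      c ∙ primeΣ φ x            ∎
      where
      instance _ = prime⇒nonZero pp
               _ = >-nonZero 1≤x
      1≤p : 1 ≤ p
      1≤p = >-nonZero⁻¹ p
      term : ℕ → ℕ → Carrier
      term n i = if does (prime? i) then φ (ν i n) else ε
      off-p : ∀ i → 1 ≤ i → i ≤ p * x → i ≢ p → term (p * x) i ≈ term x i
      off-p i _ _ i≢p with prime? i
      ... | yes pi = reflexive (cong φ (ν-*-other pi pp i≢p 1≤x))
      ... | no _ = refl
      at-p : term (p * x) p ≈ c ∙ term x p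
      at-p = begin
        term (p * x) p      ≡⟨ if-cong (dec-true (prime? p) pp) ⟩
        φ (ν p (p * x))     ≡⟨ cong φ (ν-*-self {{prime⇒nonTrivial pp}} 1≤x) ⟩
        φ (suc (ν p x))     ≈⟨ φ-step ⟩
        c ∙ φ (ν p x)       ≡⟨ cong (c ∙_) (≡.sym (if-cong (dec-true (prime? p) pp))) ⟩
        c ∙ term x p        ∎
      beyond-x : ∀ i → x < i → i ≤ p * x → term x i ≈ ε
      beyond-x i x<i _ with prime? i
      ... | yes pi = trans (reflexive (cong φ (ν-large {{prime⇒nonTrivial pi}} 1≤x x<i))) φ0≈ε
      ... | no _ = refl

module ArithmeticFunctions where

  open import Data.Bool using (true; false; if_then_else_)
  open import Data.List using ([]; _∷_; length)
  open import Data.List.Relation.Unary.All using (All; []; _∷_)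
  open import Data.Nat using (zero; _+_; _*_; _<_; z≤n; s≤s; _!; nonTrivial⇒n>1; >-nonZero)
  open import Data.Nat.ListAction using (product)
  open import Data.Nat.Properties using (≤-refl; ≤-trans; *-mono-≤; 1≤n!; m<m*n; *-comm; ≤-reflexive; *-1-commutativeMonoid; +-0-commutativeMonoid)
  open import Data.Nat.Primality using (Prime; prime?; prime⇒nonTrivial; productOfPrimes≥1)
  open import Data.Nat.Primality.Factorisation using (factorise; PrimeFactorisation)
  open import Data.Nat.Divisibility using (_∣_)
  open import Relation.Nullary using (¬_)
  open import Relation.Nullary.Decidable using (yes; no; does)
  open import Relation.Binary.PropositionalEquality using (_≡_; refl; sym; trans; cong; subst)
  open Valuation

  sumℕ : (ℕ → ℕ) → ℕ → ℕ
  sumℕ g zero    = 0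
  sumℕ g (suc n) = sumℕ g n + g (suc n)

  νℙ : ℕ → ℕ → ℕ
  νℙ p n = if does (prime? p) then ν p n else 0

  Ω : ℕ → ℕ
  Ω n = sumℕ (λ p → νℙ p n) n

  -- ξ and Ω are, by definition, the instances φ = _! and φ = id of primeΣ.
  private
    module Πℕ = RangeSum *-1-commutativeMonoid prodℕ (λ _ → refl) (λ _ _ → refl)
    module Σℕ = RangeSum +-0-commutativeMonoid sumℕ (λ _ → refl) (λ _ _ → refl)

  ξ-*-prime : ∀ {p x} → Prime p → 1 ≤ x → ξ (p * x) ≡ suc (ν p x) * ξ x
  ξ-*-prime {p} {x} pp 1≤x = Πℕ.primeΣ-*-prime {φ = _!} {c = suc (ν p x)} refl pp 1≤x refl

  Ω-*-prime : ∀ {p x} → Prime p → 1 ≤ x → Ω (p * x) ≡ suc (Ω x)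
  Ω-*-prime pp 1≤x = Σℕ.primeΣ-*-prime {φ = λ v → v} {c = 1} refl pp 1≤x refl

  ξ-positive : ∀ n → 1 ≤ ξ n
  ξ-positive n = positive n
    where
    factor : ℕ → ℕ
    factor p = if does (prime? p) then ν p n ! else 1
    factor-positive : ∀ p → 1 ≤ factor p
    factor-positive p with does (prime? p)
    ... | true  = 1≤n! (ν p n)
    ... | false = ≤-refl
    positive : ∀ m → 1 ≤ prodℕ factor m
    positive zero    = ≤-refl
    positive (suc m) = *-mono-≤ (positive m) (factor-positive (suc m))

  Ω-product : ∀ {ps} → All Prime ps → Ω (product ps) ≡ length ps
  Ω-product []         = refl
  Ω-product (pp ∷ pps) = trans (Ω-*-prime pp (productOfPrimes≥1 pps)) (cong suc (Ω-product pps))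

  length≤product : ∀ {ps} → All Prime ps → length ps ≤ product ps
  length≤product []                   = z≤n
  length≤product {p ∷ qs} (pp ∷ pps) =
    ≤-trans (s≤s (length≤product pps)) (≤-trans product<product*p (≤-reflexive (*-comm (product qs) p)))
    where
    product<product*p : product qs < product qs * p
    product<product*p = m<m*n _ p {{>-nonZero (productOfPrimes≥1 pps)}} (nonTrivial⇒n>1 p {{prime⇒nonTrivial pp}})

  Ω-≤ : ∀ {n} → 1 ≤ n → Ω n ≤ n
  Ω-≤ {n} 1≤n = subst (λ m → Ω m ≤ m) (sym isFactorisation)
                  (subst (_≤ product factors) (sym (Ω-product factorsPrime)) (length≤product factorsPrime))
    where open PrimeFactorisation (factorise n {{>-nonZero 1≤n}})

  Ω≡0⇒≡1 : ∀ {n} → 1 ≤ n → Ω n ≡ 0 → n ≡ 1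
  Ω≡0⇒≡1 {n} 1≤n Ωn≡0 with factorise n {{>-nonZero 1≤n}}
  ... | record { factors = [] ; isFactorisation = n≡1 } = n≡1
  ... | record { factors = _ ∷ _ ; isFactorisation = refl ; factorsPrime = pps } with () ← trans (sym (Ω-product pps)) Ωn≡0

  νℙ-∤ : ∀ {p n} → ¬ p ∣ n → νℙ p n ≡ 0
  νℙ-∤ {p} p∤n with prime? p
  ... | yes pp = ν-∤ {{prime⇒nonTrivial pp}} p∤n
  ... | no _   = refl

module SeriesAlgebra {c ℓ : Level} (R : CommutativeRing c ℓ) where

  open CommutativeRing R
  open FDS R
  open import Algebra.Properties.CommutativeSemigroup *-commutativeSemigroup using (x∙yz≈y∙xz)
  open import Algebra.Properties.Semiring.Mult semiring using (_×_; ×-homo-+; ×1-homo-*)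
  open import Data.Bool using (if_then_else_)
  open import Data.Bool.Properties using (if-cong)
  import Data.Nat as ℕ
  open import Data.Nat using (zero; z≤n; s≤s; _≟_)
  open import Data.Nat.Divisibility using (_∣_; _∣?_; divides)
  open import Data.Nat.Properties using (m≤m*n; *-cancelˡ-≡)
  import Data.Nat.Properties as ℕₚ
  open import Relation.Nullary using (¬_)
  open import Relation.Nullary.Decidable using (yes; no; does; dec-true; dec-false)
  open import Relation.Binary.PropositionalEquality as ≡ using (_≡_; _≢_)
  open import Relation.Binary.Reasoning.Setoid setoid
  open ArithmeticFunctions using (sumℕ)
  open RangeSum +-commutativeMonoid sumR (λ _ → refl) (λ _ _ → refl) public

  ι≈×1# : ∀ m → ι m ≈ m × 1#
  ι≈×1# zero    = refl
  ι≈×1# (suc m) = +-congˡ (ι≈×1# m)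

  ι-+ : ∀ m n → ι (m ℕ.+ n) ≈ ι m + ι n
  ι-+ m n = trans (ι≈×1# (m ℕ.+ n)) (trans (×-homo-+ 1# m n) (sym (+-cong (ι≈×1# m) (ι≈×1# n))))

  ι-* : ∀ m n → ι (m ℕ.* n) ≈ ι m * ι n
  ι-* m n = trans (ι≈×1# (m ℕ.* n)) (trans (×1-homo-* m n) (sym (*-cong (ι≈×1# m) (ι≈×1# n))))

  sumR-ι : ∀ g n → sumR (λ i → ι (g i)) n ≈ ι (sumℕ g n)
  sumR-ι g zero    = refl
  sumR-ι g (suc n) = trans (+-congʳ (sumR-ι g n)) (sym (ι-+ (sumℕ g n) (g (suc n))))

  sumR-*ˡ : ∀ x g n → x * sumR g n ≈ sumR (λ i → x * g i) n
  sumR-*ˡ x g zero    = zeroʳ x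
  sumR-*ˡ x g (suc n) = trans (distribˡ x _ _) (+-congʳ (sumR-*ˡ x g n))

  sumR-*ʳ : ∀ x g n → sumR g n * x ≈ sumR (λ i → g i * x) n
  sumR-*ʳ x g zero    = zeroˡ x
  sumR-*ʳ x g (suc n) = trans (distribʳ x _ _) (+-congʳ (sumR-*ʳ x g n))

  sumR-fibre : ∀ {d n} g x → 1 ≤ d → 1 ≤ n →
               (∀ e → d ℕ.* e ≢ n → g e ≈ 0#) → (∀ e → 1 ≤ e → d ℕ.* e ≡ n → g e ≈ x) →
               (¬ d ∣ n → x ≈ 0#) → sumR g n ≈ x
  sumR-fibre {d} {n} g x (s≤s z≤n) (s≤s z≤n) off on d∤n≈0 with d ∣? n
  ... | no d∤n = trans (Σ-ε n (λ e _ _ → off e λ de≡n → d∤n (divides e (≡.trans (≡.sym de≡n) (ℕₚ.*-comm d e)))))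
                       (sym (d∤n≈0 d∤n))
  ... | yes (divides e n≡ed) = trans (Σ-single n e 1≤e e≤n others) (on e 1≤e de≡n)
    where
    de≡n : d ℕ.* e ≡ n
    de≡n = ≡.trans (ℕₚ.*-comm d e) (≡.sym n≡ed)
    positive : ∀ {m} e′ → suc m ≡ e′ ℕ.* d → 1 ≤ e′
    positive (suc _) _ = s≤s z≤n
    1≤e : 1 ≤ e
    1≤e = positive e n≡ed
    e≤n : e ≤ n
    e≤n = ≡.subst (e ≤_) (≡.sym n≡ed) (m≤m*n e d)
    others : ∀ i → 1 ≤ i → i ≤ n → i ≢ e → g i ≈ 0#
    others i _ _ i≢e = off i (λ di≡n → i≢e (*-cancelˡ-≡ i e d (≡.trans di≡n (≡.sym de≡n))))

  sum0≈head+sumR : ∀ g n → sum0 g n ≈ g 0 + sumR g n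
  sum0≈head+sumR g zero    = sym (+-identityʳ (g 0))
  sum0≈head+sumR g (suc n) = trans (+-congʳ (sum0≈head+sumR g n)) (+-assoc _ _ _)

  sum0-cong : ∀ {g h} n → (∀ k → g k ≈ h k) → sum0 g n ≈ sum0 h n
  sum0-cong zero    g≈h = g≈h 0
  sum0-cong (suc n) g≈h = +-cong (sum0-cong n g≈h) (g≈h (suc n))

  sum0-indicator : ∀ {j N} y → j ≤ N → sum0 (λ k → if does (j ≟ k) then y else 0#) N ≈ y
  sum0-indicator {zero} {N} y _ = begin
    sum0 δ₀ N        ≈⟨ sum0≈head+sumR δ₀ N ⟩
    y + sumR δ₀ N    ≈⟨ +-congˡ (Σ-ε N λ { (suc _) _ _ → refl }) ⟩
    y + 0#           ≈⟨ +-identityʳ y ⟩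
    y                ∎
    where δ₀ = λ k → if does (0 ≟ k) then y else 0#
  sum0-indicator {suc j} {N} y j≤N = begin
    sum0 δⱼ N        ≈⟨ sum0≈head+sumR δⱼ N ⟩
    0# + sumR δⱼ N   ≈⟨ +-identityˡ _ ⟩
    sumR δⱼ N        ≈⟨ Σ-single N (suc j) (s≤s z≤n) j≤N
                          (λ i _ _ i≢j → reflexive (if-cong (dec-false (suc j ≟ i) (λ j≡i → i≢j (≡.sym j≡i))))) ⟩
    δⱼ (suc j)       ≡⟨ if-cong (dec-true (suc j ≟ suc j) ≡.refl) ⟩
    y                ∎
    where δⱼ = λ k → if does (suc j ≟ k) then y else 0#

module PrimePowers {c ℓ : Level} (R : CommutativeRing c ℓ) where

  open CommutativeRing R
  open FDS R
  open SeriesAlgebra R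
  open Valuation
  open ArithmeticFunctions
  open import Algebra.Properties.CommutativeSemigroup *-commutativeSemigroup using (x∙yz≈y∙xz)
  open import Data.Bool using (if_then_else_)
  open import Data.Bool.Properties using (if-cong)
  open import Data.Nat using (zero; z≤n; s≤s; _≟_; _!; 2+)
  import Data.Nat as ℕ
  open import Data.Nat.Properties using (suc-injective; 1≤n!)
  open import Data.Nat.Primality using (Prime; prime?; prime⇒nonTrivial; prime⇒nonZero)
  open import Data.Product using (proj₁; proj₂)
  open import Relation.Nullary.Decidable using (yes; no; does; dec-true; dec-false)
  open import Relation.Binary.PropositionalEquality as ≡ using (_≡_; _≢_; cong; cong₂)
  open import Relation.Binary.Reasoning.Setoid setoid

  module _ (f : ℕ → Carrier) (f-cm : CompletelyMultiplicative f) where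

    P : Series
    P = primeSeries f

    Ω-slice : ℕ → Carrier → Series
    Ω-slice k x n = if does (Ω n ≟ k) then x * f n else 0#

    Ω-slice-≡ : ∀ {k x n} → Ω n ≡ k → Ω-slice k x n ≡ x * f n
    Ω-slice-≡ {k} {n = n} Ωn≡k = if-cong (dec-true (Ω n ≟ k) Ωn≡k)

    Ω-slice-≢ : ∀ {k x n} → Ω n ≢ k → Ω-slice k x n ≡ 0#
    Ω-slice-≢ {k} {n = n} Ωn≢k = if-cong (dec-false (Ω n ≟ k) Ωn≢k)

    Ω-slice-*ˡ : ∀ a k x n → a * Ω-slice k x n ≈ Ω-slice k (a * x) n
    Ω-slice-*ˡ a k x n with Ω n ≟ k
    ... | yes Ωn≡k = begin
      a * Ω-slice k x n    ≡⟨ cong (a *_) (Ω-slice-≡ Ωn≡k) ⟩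
      a * (x * f n)        ≈⟨ sym (*-assoc a x (f n)) ⟩
      (a * x) * f n        ≡⟨ ≡.sym (Ω-slice-≡ Ωn≡k) ⟩
      Ω-slice k (a * x) n  ∎
    ... | no Ωn≢k = begin
      a * Ω-slice k x n    ≡⟨ cong (a *_) (Ω-slice-≢ Ωn≢k) ⟩
      a * 0#               ≈⟨ zeroʳ a ⟩
      0#                   ≡⟨ ≡.sym (Ω-slice-≢ Ωn≢k) ⟩
      Ω-slice k (a * x) n  ∎

    Ω-slice-cong : ∀ {x y} k n → x ≈ y → Ω-slice k x n ≈ Ω-slice k y n
    Ω-slice-cong {x} {y} k n x≈y with Ω n ≟ k
    ... | yes Ωn≡k = begin
      Ω-slice k x n  ≡⟨ Ω-slice-≡ Ωn≡k ⟩
      x * f n        ≈⟨ *-congʳ x≈y ⟩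
      y * f n        ≡⟨ ≡.sym (Ω-slice-≡ Ωn≡k) ⟩
      Ω-slice k y n  ∎
    ... | no Ωn≢k = reflexive (≡.trans (Ω-slice-≢ Ωn≢k) (≡.sym (Ω-slice-≢ Ωn≢k)))

    Ω-slice-*-prime : ∀ {p e} k x → Prime p → 1 ≤ e → f p * Ω-slice k x e ≈ Ω-slice (suc k) x (p ℕ.* e)
    Ω-slice-*-prime {p} {e} k x pp 1≤e with Ω e ≟ k
    ... | yes Ωe≡k = begin
      f p * Ω-slice k x e               ≡⟨ cong (f p *_) (Ω-slice-≡ Ωe≡k) ⟩
      f p * (x * f e)                   ≈⟨ x∙yz≈y∙xz (f p) x (f e) ⟩
      x * (f p * f e)                   ≈⟨ *-congˡ (sym (proj₂ f-cm p e (ℕ.>-nonZero⁻¹ p {{prime⇒nonZero pp}}) 1≤e)) ⟩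
      x * f (p ℕ.* e)                   ≡⟨ ≡.sym (Ω-slice-≡ (≡.trans (Ω-*-prime pp 1≤e) (cong suc Ωe≡k))) ⟩
      Ω-slice (suc k) x (p ℕ.* e)       ∎
    ... | no Ωe≢k = begin
      f p * Ω-slice k x e               ≡⟨ cong (f p *_) (Ω-slice-≢ Ωe≢k) ⟩
      f p * 0#                          ≈⟨ zeroʳ (f p) ⟩
      0#                                ≡⟨ ≡.sym (Ω-slice-≢ (λ Ωpe≡1+k → Ωe≢k (suc-injective
                                             (≡.trans (≡.sym (Ω-*-prime pp 1≤e)) Ωpe≡1+k)))) ⟩
      Ω-slice (suc k) x (p ℕ.* e)       ∎

    Ω-slice-weight : ∀ k n → ι (Ω n) * Ω-slice (suc k) (ι (k !)) n ≈ Ω-slice (suc k) (ι (suc k !)) n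
    Ω-slice-weight k n with Ω n ≟ suc k
    ... | yes Ωn≡1+k = begin
      ι (Ω n) * Ω-slice (suc k) (ι (k !)) n   ≡⟨ cong₂ (λ m y → ι m * y) Ωn≡1+k (Ω-slice-≡ Ωn≡1+k) ⟩
      ι (suc k) * (ι (k !) * f n)             ≈⟨ sym (*-assoc _ _ _) ⟩
      (ι (suc k) * ι (k !)) * f n             ≈⟨ *-congʳ (sym (ι-* (suc k) (k !))) ⟩
      ι (suc k !) * f n                       ≡⟨ ≡.sym (Ω-slice-≡ Ωn≡1+k) ⟩
      Ω-slice (suc k) (ι (suc k !)) n         ∎
    ... | no Ωn≢1+k = begin
      ι (Ω n) * Ω-slice (suc k) (ι (k !)) n   ≡⟨ cong (ι (Ω n) *_) (Ω-slice-≢ Ωn≢1+k) ⟩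
      ι (Ω n) * 0#                            ≈⟨ zeroʳ _ ⟩
      0#                                      ≡⟨ ≡.sym (Ω-slice-≢ Ωn≢1+k) ⟩
      Ω-slice (suc k) (ι (suc k !)) n         ∎

    divisor-term : ∀ k {d e n} → d ℕ.* e ≡ n → 1 ≤ e → ι (ξ e) * (P ^⋆ k) e ≈ Ω-slice k (ι (k !)) e →
                   ι (ξ n) * (P d * (P ^⋆ k) e) ≈ ι (νℙ d n) * Ω-slice (suc k) (ι (k !)) n
    -- Abstracting prime? d unfolds P d to f d (resp. 0#) and νℙ d n to ν d n (resp. 0).
    divisor-term k {d} {e} ≡.refl 1≤e ih with prime? d
    ... | yes pd = begin
      ι (ξ (d ℕ.* e)) * (f d * (P ^⋆ k) e)                 ≡⟨ cong (λ m → ι m * (f d * (P ^⋆ k) e)) (ξ-*-prime pd 1≤e) ⟩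
      ι (suc v ℕ.* ξ e) * (f d * (P ^⋆ k) e)               ≈⟨ *-congʳ (ι-* (suc v) (ξ e)) ⟩
      (ι (suc v) * ι (ξ e)) * (f d * (P ^⋆ k) e)           ≈⟨ *-assoc _ _ _ ⟩
      ι (suc v) * (ι (ξ e) * (f d * (P ^⋆ k) e))           ≈⟨ *-congˡ (x∙yz≈y∙xz _ _ _) ⟩
      ι (suc v) * (f d * (ι (ξ e) * (P ^⋆ k) e))           ≈⟨ *-congˡ (*-congˡ ih) ⟩
      ι (suc v) * (f d * Ω-slice k (ι (k !)) e)            ≈⟨ *-congˡ (Ω-slice-*-prime k (ι (k !)) pd 1≤e) ⟩
      ι (suc v) * Ω-slice (suc k) (ι (k !)) (d ℕ.* e)      ≡⟨ cong (λ m → ι m * Ω-slice (suc k) (ι (k !)) (d ℕ.* e))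
                                                                   (≡.sym (ν-*-self {{prime⇒nonTrivial pd}} 1≤e)) ⟩
      ι (ν d (d ℕ.* e)) * Ω-slice (suc k) (ι (k !)) (d ℕ.* e) ∎
      where v = ν d e
    ... | no _ = begin
      ι (ξ (d ℕ.* e)) * (0# * (P ^⋆ k) e)   ≈⟨ *-congˡ (zeroˡ _) ⟩
      ι (ξ (d ℕ.* e)) * 0#                  ≈⟨ zeroʳ _ ⟩
      0#                                    ≈⟨ sym (zeroˡ _) ⟩
      0# * Ω-slice (suc k) (ι (k !)) (d ℕ.* e) ∎

    power-coefficient : ∀ k {n} → 1 ≤ n → ι (ξ n) * (P ^⋆ k) n ≈ Ω-slice k (ι (k !)) n
    power-coefficient zero {1} _ = *-congˡ (sym (proj₁ f-cm))
    power-coefficient zero {n@(2+ _)} _ = trans (zeroʳ _) (reflexive (≡.sym (Ω-slice-≢ Ωn≢0)))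
      where
      Ωn≢0 : Ω n ≢ 0
      Ωn≢0 Ωn≡0 with () ← Ω≡0⇒≡1 {n} (s≤s z≤n) Ωn≡0
    power-coefficient (suc k) {n} 1≤n = begin
      ι (ξ n) * sumR (λ d → sumR (T d) n) n              ≈⟨ sumR-*ˡ _ _ n ⟩
      sumR (λ d → ι (ξ n) * sumR (T d) n) n              ≈⟨ Σ-cong n (λ d 1≤d _ → trans (sumR-*ˡ _ _ n) (fibre d 1≤d)) ⟩
      sumR (λ d → ι (νℙ d n) * slice) n                 ≈⟨ sym (sumR-*ʳ slice _ n) ⟩
      sumR (λ d → ι (νℙ d n)) n * slice                 ≈⟨ *-congʳ (sumR-ι (λ d → νℙ d n) n) ⟩
      ι (Ω n) * slice                                    ≈⟨ Ω-slice-weight k n ⟩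
      Ω-slice (suc k) (ι (suc k !)) n                    ∎
      where
      slice = Ω-slice (suc k) (ι (k !)) n
      T : ℕ → ℕ → Carrier
      T d e = if does (d ℕ.* e ≟ n) then P d * (P ^⋆ k) e else 0#
      fibre : ∀ d → 1 ≤ d → sumR (λ e → ι (ξ n) * T d e) n ≈ ι (νℙ d n) * slice
      fibre d 1≤d = sumR-fibre _ _ 1≤d 1≤n
        (λ e de≢n → trans (*-congˡ (reflexive (if-cong (dec-false (d ℕ.* e ≟ n) de≢n)))) (zeroʳ _))
        (λ e 1≤e de≡n → trans (*-congˡ (reflexive (if-cong (dec-true (d ℕ.* e ≟ n) de≡n))))
                              (divisor-term k de≡n 1≤e (power-coefficient k 1≤e)))
        (λ d∤n → trans (*-congʳ (reflexive (cong ι (νℙ-∤ d∤n)))) (zeroˡ _))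

    module _ (inv : ℕ → Carrier) (ι*inv≈1 : ∀ m → 1 ≤ m → ι m * inv m ≈ 1#) where

      inv*ι≈1 : ∀ m → 1 ≤ m → inv m * ι m ≈ 1#
      inv*ι≈1 m 1≤m = trans (*-comm _ _) (ι*inv≈1 m 1≤m)

      exponential-term : ∀ k {n} → 1 ≤ n → inv (k !) * (P ^⋆ k) n ≈ Ω-slice k (inv (ξ n)) n
      exponential-term k {n} 1≤n = begin
        inv (k !) * (P ^⋆ k) n                                  ≈⟨ *-congˡ (sym cancel-ξ) ⟩
        inv (k !) * (inv (ξ n) * (ι (ξ n) * (P ^⋆ k) n))        ≈⟨ *-congˡ (*-congˡ (power-coefficient k 1≤n)) ⟩
        inv (k !) * (inv (ξ n) * Ω-slice k (ι (k !)) n)         ≈⟨ trans (*-congˡ (Ω-slice-*ˡ _ k _ n)) (Ω-slice-*ˡ _ k _ n) ⟩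
        Ω-slice k (inv (k !) * (inv (ξ n) * ι (k !))) n         ≈⟨ Ω-slice-cong k n cancel-k! ⟩
        Ω-slice k (inv (ξ n)) n                                 ∎
        where
        cancel-ξ : inv (ξ n) * (ι (ξ n) * (P ^⋆ k) n) ≈ (P ^⋆ k) n
        cancel-ξ = trans (sym (*-assoc _ _ _)) (trans (*-congʳ (inv*ι≈1 (ξ n) (ξ-positive n))) (*-identityˡ _))
        cancel-k! : inv (k !) * (inv (ξ n) * ι (k !)) ≈ inv (ξ n)
        cancel-k! = trans (x∙yz≈y∙xz _ _ _) (trans (*-congˡ (inv*ι≈1 (k !) (1≤n! k))) (*-identityʳ _))

theorem5p2 : {c ℓ : Level} (R : CommutativeRing c ℓ) →
    let open CommutativeRing R
        open FDS R in
    (inv : ℕ → Carrier) → (∀ m → 1 ≤ m → ι m * inv m ≈ 1#) →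
    (f : ℕ → Carrier) → CompletelyMultiplicative f →
    expDS inv f ≋ expD inv (primeSeries f)
theorem5p2 R inv ι*inv≈1 f f-cm n 1≤n = begin
  f n * inv (ξ n)                                ≈⟨ *-comm _ _ ⟩
  inv (ξ n) * f n                                ≈⟨ sym (sum0-indicator _ (Ω-≤ 1≤n)) ⟩
  sum0 (λ k → Ω-slice f f-cm k (inv (ξ n)) n) n  ≈⟨ sum0-cong n (λ k → sym (exponential-term f f-cm inv ι*inv≈1 k 1≤n)) ⟩
  expD inv (primeSeries f) n                     ∎
  where
  open CommutativeRing R
  open FDS R
  open SeriesAlgebra R
  open PrimePowers R
  open ArithmeticFunctions using (Ω-≤)
  open import Relation.Binary.Reasoning.Setoid setoid
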